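{- Let $X$ be a finite set, $f\in\mathrm{Bool}(X)$ the rank function of a matroid, and $\sim$ an equivalence relation on $X$. Then $f/{\sim}$ is increasing and submodular. Moreover, $f/{\sim}$ is the rank function of a matroid if and only if $f(Y)\le 1$ for every class $Y\in X/{\sim}$.
   Context: A boolean function on a finite set $X$ is $f:\mathcal{P}(X)\to\mathbb{Z}$ with $f(\emptyset)=0$. It is the rank function of a matroid if (1) $0\le f(A)\le|A|$ for all $A\subseteq X$; (2) $f$ is increasing: $A\subseteq B\Rightarrow f(A)\le f(B)$; (3) $f$ is submodular: $f(A\cup B)+f(A\cap B)\le f(A)+f(B)$ for all $A,B$. For an equivalence $\sim$ on $X$ with canonical projection $\varpi_\sim:X\to X/{\sim}$, $f/{\sim}$ is the boolean function on $X/{\sim}$ given by $f/{\sim}(A)=f(\varpi_\sim^{ -1}(A))$. -}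

module Defs where

open import Data.Nat using (ℕ)
open import Data.Fin using (Fin)
open import Data.Fin.Subset using (Subset; ⊥; _⊆_; _∪_; _∩_; ∣_∣)
open import Data.Integer using (ℤ; +_; _+_; _≤_)
open import Data.Product using (_×_; ∃)
open import Data.Vec using (tabulate; lookup)
open import Relation.Binary.PropositionalEquality using (_≡_)

-- Boolean functions on the finite set Fin n are maps Subset n → ℤ
-- (the condition f ∅ = 0 is imposed where needed, see IsMatroidRank).

preimage : ∀ {n m} → (Fin n → Fin m) → Subset m → Subset n
preimage π A = tabulate (λ x → lookup A (π x))

IsSurjection : ∀ {n m} → (Fin n → Fin m) → Set
IsSurjection π = ∀ c → ∃ λ x → π x ≡ c

-- f/∼ where the quotient X/∼ is given by the canonical projection π
quot : ∀ {n m} → (Subset n → ℤ) → (Fin n → Fin m) → Subset m → ℤ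
quot f π A = f (preimage π A)

IsIncreasing : ∀ {n} → (Subset n → ℤ) → Set
IsIncreasing f = ∀ A B → A ⊆ B → f A ≤ f B

IsSubmodular : ∀ {n} → (Subset n → ℤ) → Set
IsSubmodular f = ∀ A B → f (A ∪ B) + f (A ∩ B) ≤ f A + f B

IsMatroidRank : ∀ {n} → (Subset n → ℤ) → Set
IsMatroidRank f =
  f ⊥ ≡ + 0 ×
  (∀ A → (+ 0 ≤ f A) × (f A ≤ + ∣ A ∣)) ×
  IsIncreasing f ×
  IsSubmodular f

{-# OPTIONS --safe #-}
-- Taking preimages under the projection preserves ⊥, ∪, ∩ and ⊆, so f/∼ inherits
-- f ∅ = 0, nonnegativity, monotonicity and submodularity from f.  The only matroid
-- axiom left is f/∼ A ≤ ∣ A ∣.  On a singleton {Y} it says f Y ≤ 1; conversely a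
-- nonnegative submodular function is subadditive, so f/∼ A is at most the sum of
-- f/∼ over the singletons of A, which is ∣ A ∣ when every class has rank ≤ 1.
module Submission where

open import Defs
open import Data.Bool using (Bool; true; false; _∨_; _∧_)
open import Data.Fin using (Fin; zero; suc)
open import Data.Fin.Subset using (Subset; ⁅_⁆; ⊥; _∪_; _∩_; _⊆_; _∈_; ∣_∣)
open import Data.Fin.Subset.Properties using (∣⁅x⁆∣≡1; ∪-identityˡ)
open import Data.Integer using (ℤ; +_; _+_; _≤_; nonNegative)
open import Data.Integer.Properties using (≤-refl; ≤-trans; +-mono-≤; i≤i+j)
open import Data.Nat using (ℕ)
open import Data.Product using (_×_; _,_; proj₁; proj₂)
open import Data.Vec using ([]; _∷_; tabulate; lookup; zipWith; replicate)
open import Data.Vec.Properties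
  using (lookup-zipWith; lookup-replicate; lookup∘tabulate; tabulate-cong; tabulate-allFin; map-const; []=⇒lookup; lookup⇒[]=)
open import Function using (_∘_; const)
open import Function.Bundles using (_⇔_; mk⇔)
open import Relation.Binary.PropositionalEquality using (_≡_; refl; sym; trans; cong; subst; subst₂)

private
  variable
    A : Set
    k n m : ℕ

tabulate-zipWith : ∀ (op : A → A → A) (g h : Fin n → A) →
  tabulate (λ i → op (g i) (h i)) ≡ zipWith op (tabulate g) (tabulate h)
tabulate-zipWith {n = ℕ.zero}  op g h = refl
tabulate-zipWith {n = ℕ.suc n} op g h =
  cong (op (g zero) (h zero) ∷_) (tabulate-zipWith op (g ∘ suc) (h ∘ suc))

tabulate-const : ∀ (x : A) → tabulate {n = n} (const x) ≡ replicate n x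
tabulate-const x = trans (tabulate-allFin (const x)) (map-const _ x)

module _ (π : Fin n → Fin m) where

  preimage-zipWith : ∀ (op : Bool → Bool → Bool) (P Q : Subset m) →
    preimage π (zipWith op P Q) ≡ zipWith op (preimage π P) (preimage π Q)
  preimage-zipWith op P Q =
    trans (tabulate-cong (λ x → lookup-zipWith op (π x) P Q))
          (tabulate-zipWith op (lookup P ∘ π) (lookup Q ∘ π))

  preimage-⊥ : preimage π ⊥ ≡ ⊥
  preimage-⊥ = trans (tabulate-cong (λ x → lookup-replicate (π x) false)) (tabulate-const false)

  ∈-preimage⁺ : ∀ {x P} → π x ∈ P → x ∈ preimage π P
  ∈-preimage⁺ {x} πx∈P = lookup⇒[]= x _ (trans (lookup∘tabulate _ x) ([]=⇒lookup πx∈P))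

  ∈-preimage⁻ : ∀ {x P} → x ∈ preimage π P → π x ∈ P
  ∈-preimage⁻ {x} {P} x∈ =
    lookup⇒[]= (π x) P (trans (sym (lookup∘tabulate (lookup P ∘ π) x)) ([]=⇒lookup x∈))

  preimage-mono : ∀ {P Q} → P ⊆ Q → preimage π P ⊆ preimage π Q
  preimage-mono P⊆Q = ∈-preimage⁺ ∘ P⊆Q ∘ ∈-preimage⁻

module _ (f : Subset n → ℤ) (π : Fin n → Fin m) where

  quot-⊥ : f ⊥ ≡ + 0 → quot f π ⊥ ≡ + 0
  quot-⊥ f⊥ = trans (cong f (preimage-⊥ π)) f⊥

  quot-increasing : IsIncreasing f → IsIncreasing (quot f π)
  quot-increasing inc P Q P⊆Q = inc _ _ (preimage-mono π P⊆Q)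

  quot-submodular : IsSubmodular f → IsSubmodular (quot f π)
  quot-submodular sub P Q =
    subst₂ (λ U V → f U + f V ≤ quot f π P + quot f π Q)
      (sym (preimage-zipWith π _∨_ P Q)) (sym (preimage-zipWith π _∧_ P Q))
      (sub (preimage π P) (preimage π Q))

IsSubadditive : (Subset k → ℤ) → Set
IsSubadditive g = ∀ P Q → g (P ∪ Q) ≤ g P + g Q

nonneg∧submodular⇒subadditive : {g : Subset k → ℤ} →
  (∀ P → + 0 ≤ g P) → IsSubmodular g → IsSubadditive g
nonneg∧submodular⇒subadditive {g = g} nonneg sub P Q =
  ≤-trans (i≤i+j (g (P ∪ Q)) (g (P ∩ Q)) {{nonNegative (nonneg (P ∩ Q))}}) (sub P Q)

subadditive⇒≤∣_∣ : ∀ {g : Subset k → ℤ} → g ⊥ ≡ + 0 → IsSubadditive g →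
  (∀ c → g ⁅ c ⁆ ≤ + 1) → ∀ P → g P ≤ + ∣ P ∣
subadditive⇒≤∣_∣ g⊥ sub single [] = subst (_≤ + 0) (sym g⊥) ≤-refl
subadditive⇒≤∣_∣ {g = g} g⊥ sub single (b ∷ P) = bound b
  where
  tail-bound : g (false ∷ P) ≤ + ∣ P ∣
  tail-bound = subadditive⇒≤∣_∣ g⊥ (λ Q R → sub (false ∷ Q) (false ∷ R)) (single ∘ suc) P

  bound : ∀ b → g (b ∷ P) ≤ + ∣ b ∷ P ∣
  bound false = tail-bound
  bound true  = subst (λ Q → g (true ∷ Q) ≤ + 1 + + ∣ P ∣) (∪-identityˡ P)
    (≤-trans (sub ⁅ zero ⁆ (false ∷ P)) (+-mono-≤ (single zero) tail-bound))

lemma4p22 : ∀ {n m} (f : Subset n → ℤ) (π : Fin n → Fin m) →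
    IsSurjection π → IsMatroidRank f →
    IsIncreasing (quot f π) × IsSubmodular (quot f π) ×
    (IsMatroidRank (quot f π) ⇔ (∀ (c : Fin m) → f (preimage π ⁅ c ⁆) ≤ + 1))
lemma4p22 f π _ (f⊥ , bounds , inc , sub) = inc/∼ , sub/∼ , mk⇔ rank⇒classes≤1 classes≤1⇒rank
  where
  inc/∼ : IsIncreasing (quot f π)
  inc/∼ = quot-increasing f π inc

  sub/∼ : IsSubmodular (quot f π)
  sub/∼ = quot-submodular f π sub

  ⊥/∼ : quot f π ⊥ ≡ + 0
  ⊥/∼ = quot-⊥ f π f⊥

  nonneg/∼ : ∀ P → + 0 ≤ quot f π P
  nonneg/∼ P = proj₁ (bounds (preimage π P))

  rank⇒classes≤1 : IsMatroidRank (quot f π) → ∀ c → quot f π ⁅ c ⁆ ≤ + 1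
  rank⇒classes≤1 (_ , bounds/∼ , _) c =
    subst (λ i → quot f π ⁅ c ⁆ ≤ + i) (∣⁅x⁆∣≡1 c) (proj₂ (bounds/∼ ⁅ c ⁆))

  classes≤1⇒rank : (∀ c → quot f π ⁅ c ⁆ ≤ + 1) → IsMatroidRank (quot f π)
  classes≤1⇒rank classes≤1 = ⊥/∼ , bounds/∼ , inc/∼ , sub/∼
    where
    bounds/∼ : ∀ P → (+ 0 ≤ quot f π P) × (quot f π P ≤ + ∣ P ∣)
    bounds/∼ P = nonneg/∼ P
      , subadditive⇒≤∣_∣ ⊥/∼ (nonneg∧submodular⇒subadditive nonneg/∼ sub/∼) classes≤1 P
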